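{- Let $D$ be the formal derivative with respect to the context-free grammar $z \rightarrow x^2z,\ x \rightarrow x^2$. For every integer $n\geq 1$, \[ D^n(z)=x^n z\sum_{k=1}^n L(n,k)\, x^{k}, \] where $L(n,k)=\binom{n-1}{k-1}\frac{n!}{k!}$ are the signless Lah numbers.
   Context: The formal derivative $D$ with respect to a grammar is the unique linear operator on polynomials in the letters that sends each letter to its image under the grammar's rule and satisfies the Leibniz rule $D(uv)=D(u)v+uD(v)$. -}

module Defs where

open import Data.Nat using (ℕ; zero; suc; _+_; _*_; _∸_; _!)
open import Data.Nat.Properties using (_!≢0)
open import Data.Nat.DivMod using (_/_)
open import Data.Nat.Combinatorics using (_C_)

infixl 6 _⊕_
infixl 7 _⊗_
data Expr : Set where
  lit : ℕ → Expr
  X   : Expr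
  Z   : Expr
  _⊕_ : Expr → Expr → Expr
  _⊗_ : Expr → Expr → Expr

-- Semantics: a polynomial is its coefficient function,
-- ⟦ p ⟧ i j = coefficient of x^i z^j.
Poly : Set
Poly = ℕ → ℕ → ℕ

sumTo : ℕ → (ℕ → ℕ) → ℕ
sumTo zero    f = f zero
sumTo (suc n) f = sumTo n f + f (suc n)

conv : Poly → Poly → Poly
conv p q i j = sumTo i (λ a → sumTo j (λ b → p a b * q (i ∸ a) (j ∸ b)))

⟦_⟧ : Expr → Poly
⟦ lit c ⟧ zero zero = c
⟦ lit c ⟧ _    _    = 0
⟦ X ⟧ (suc zero) zero = 1
⟦ X ⟧ _          _    = 0
⟦ Z ⟧ zero (suc zero) = 1
⟦ Z ⟧ _    _          = 0
⟦ p ⊕ q ⟧ i j = ⟦ p ⟧ i j + ⟦ q ⟧ i j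
⟦ p ⊗ q ⟧ i j = conv ⟦ p ⟧ ⟦ q ⟧ i j

D : Expr → Expr
D (lit c) = lit 0
D X       = X ⊗ X
D Z       = X ⊗ X ⊗ Z
D (p ⊕ q) = D p ⊕ D q
D (p ⊗ q) = D p ⊗ q ⊕ p ⊗ D q

Dⁿ : ℕ → Expr → Expr
Dⁿ zero    p = p
Dⁿ (suc n) p = D (Dⁿ n p)

X^ : ℕ → Expr
X^ zero    = lit 1
X^ (suc n) = X^ n ⊗ X

Lah : ℕ → ℕ → ℕ
Lah n k = ((n ∸ 1) C (k ∸ 1)) * ((n !) / (k !)) {{k !≢0}}

lahSum : ℕ → ℕ → Expr
lahSum n zero    = lit 0
lahSum n (suc k) = lahSum n k ⊕ lit (Lah n (suc k)) ⊗ X^ (suc k)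

-- On coefficient functions the grammar derivative is x·Eₓ + x²·E_z, where the Euler
-- operators Eₓ, E_z multiply the coefficient of xⁱzʲ by i resp. j.  Euler operators are
-- derivations because degrees add under multiplication, and a derivation multiplied by x
-- is again one, so ⟦ D p ⟧ is computed from ⟦ p ⟧ alone.  Hence Dⁿz = z·fₙ(x) with f₀ = 1
-- and fₙ₊₁ = x²(fₙ + fₙ'); comparing coefficients, xⁿ⁺ᵏ in fₙ satisfies the Lah recurrence
-- L(n+1,k) = (n+k)·L(n,k) + L(n,k−1).  The closed form L(n+1,k+1)·(k+1)! = C(n,k)·(n+1)!
-- then follows by induction from Pascal's rule and the absorption identity.
module Submission where

open import Algebra.Properties.CommutativeSemigroup using (interchange)
open import Data.Nat
open import Data.Nat.Combinatorics using (_C_; nC1≡n; k>n⇒nCk≡0; nCk+nC[k+1]≡[n+1]C[k+1]; k![n∸k]!∣n!)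
open import Data.Nat.Divisibility using (∣-trans; m∣m*n)
open import Data.Nat.DivMod using (_/_; *-/-assoc; m*n/n≡m)
open import Data.Nat.Properties
open import Data.Nat.Tactic.RingSolver using (solve-∀)
open import Function using (_∘_)
open import Relation.Binary.PropositionalEquality
open import Relation.Nullary using (yes; no)

open import Defs

+-interchange : ∀ a b c d → a + b + (c + d) ≡ a + c + (b + d)
+-interchange = interchange +-commutativeSemigroup

sumTo-cong : ∀ n {f g : ℕ → ℕ} → (∀ a → a ≤ n → f a ≡ g a) → sumTo n f ≡ sumTo n g
sumTo-cong zero    f≗g = f≗g 0 z≤n
sumTo-cong (suc n) f≗g =
  cong₂ _+_ (sumTo-cong n λ a a≤n → f≗g a (m≤n⇒m≤1+n a≤n)) (f≗g (suc n) ≤-refl)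

sumTo-zero : ∀ n {f : ℕ → ℕ} → (∀ a → f a ≡ 0) → sumTo n f ≡ 0
sumTo-zero zero    f≗0 = f≗0 0
sumTo-zero (suc n) f≗0 = cong₂ _+_ (sumTo-zero n f≗0) (f≗0 (suc n))

sumTo-+ : ∀ n (f g : ℕ → ℕ) → sumTo n (λ a → f a + g a) ≡ sumTo n f + sumTo n g
sumTo-+ zero    f g = refl
sumTo-+ (suc n) f g = trans (cong (_+ (f (suc n) + g (suc n))) (sumTo-+ n f g))
                            (+-interchange (sumTo n f) _ _ _)

*-distribˡ-sumTo : ∀ c n (f : ℕ → ℕ) → c * sumTo n f ≡ sumTo n (λ a → c * f a)
*-distribˡ-sumTo c zero    f = refl
*-distribˡ-sumTo c (suc n) f =
  trans (*-distribˡ-+ c (sumTo n f) (f (suc n))) (cong (_+ c * f (suc n)) (*-distribˡ-sumTo c n f))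

sumTo-suc : ∀ n (f : ℕ → ℕ) → sumTo (suc n) f ≡ f 0 + sumTo n (f ∘ suc)
sumTo-suc zero    f = refl
sumTo-suc (suc n) f = trans (cong (_+ f (suc (suc n))) (sumTo-suc n f)) (+-assoc (f 0) _ _)

δ : ℕ → ℕ → ℕ
δ zero    zero    = 1
δ zero    (suc i) = 0
δ (suc a) zero    = 0
δ (suc a) (suc i) = δ a i

step : ℕ → ℕ → ℕ
step zero    i       = 1
step (suc a) zero    = 0
step (suc a) (suc i) = step a i

δ-subst : ∀ a i (f : ℕ → ℕ) → δ a i * f i ≡ δ a i * f a
δ-subst zero    zero    f = refl
δ-subst zero    (suc i) f = refl
δ-subst (suc a) zero    f = refl
δ-subst (suc a) (suc i) f = δ-subst a i (f ∘ suc)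

step-≤ : ∀ {a i} → a ≤ i → step a i ≡ 1
step-≤ z≤n       = refl
step-≤ (s≤s a≤i) = step-≤ a≤i

step-> : ∀ {a i} → i < a → step a i ≡ 0
step-> {suc a} {zero}  _         = refl
step-> {suc a} {suc i} (s≤s i<a) = step-> i<a

step-suc : ∀ i m → step i (suc m) ≡ step i m + δ (suc m) i
step-suc zero          m       = refl
step-suc (suc zero)    zero    = refl
step-suc (suc (suc i)) zero    = refl
step-suc (suc i)       (suc m) = step-suc i m

step-δ : ∀ a b i → step a i * δ b (i ∸ a) ≡ δ (a + b) i
step-δ zero    b i       = +-identityʳ (δ b i)
step-δ (suc a) b zero    = refl
step-δ (suc a) b (suc i) = step-δ a b i

sumTo-δ : ∀ a n (f : ℕ → ℕ) → sumTo n (λ x → δ a x * f x) ≡ step a n * f a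
sumTo-δ zero    zero    f = refl
sumTo-δ zero    (suc n) f =
  trans (sumTo-suc n _) (trans (cong (f 0 + 0 +_) (sumTo-zero n λ _ → refl)) (+-identityʳ _))
sumTo-δ (suc a) zero    f = refl
sumTo-δ (suc a) (suc n) f = trans (sumTo-suc n _) (sumTo-δ a n (f ∘ suc))

infix 4 _≈_
_≈_ : Poly → Poly → Set
f ≈ g = ∀ i j → f i j ≡ g i j

≈-refl : ∀ {f} → f ≈ f
≈-refl i j = refl

≈-sym : ∀ {f g} → f ≈ g → g ≈ f
≈-sym f≈g i j = sym (f≈g i j)

≈-trans : ∀ {f g h} → f ≈ g → g ≈ h → f ≈ h
≈-trans f≈g g≈h i j = trans (f≈g i j) (g≈h i j)

infixl 6 _⊞_
_⊞_ : Poly → Poly → Poly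
(f ⊞ g) i j = f i j + g i j

⊞-cong : ∀ {f f′ g g′} → f ≈ f′ → g ≈ g′ → f ⊞ g ≈ f′ ⊞ g′
⊞-cong f≈f′ g≈g′ i j = cong₂ _+_ (f≈f′ i j) (g≈g′ i j)

conv-cong : ∀ {f f′ g g′} → f ≈ f′ → g ≈ g′ → conv f g ≈ conv f′ g′
conv-cong f≈f′ g≈g′ i j =
  sumTo-cong i λ a _ → sumTo-cong j λ b _ → cong₂ _*_ (f≈f′ a b) (g≈g′ (i ∸ a) (j ∸ b))

doubleSum-+ : ∀ i j (f g : ℕ → ℕ → ℕ) →
  sumTo i (λ a → sumTo j (λ b → f a b + g a b))
    ≡ sumTo i (λ a → sumTo j (f a)) + sumTo i (λ a → sumTo j (g a))
doubleSum-+ i j f g = trans (sumTo-cong i λ a _ → sumTo-+ j (f a) (g a)) (sumTo-+ i _ _)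

conv-distribʳ-⊞ : ∀ f g h → conv (f ⊞ g) h ≈ conv f h ⊞ conv g h
conv-distribʳ-⊞ f g h i j =
  trans (sumTo-cong i λ a _ → sumTo-cong j λ b _ → *-distribʳ-+ (h (i ∸ a) (j ∸ b)) (f a b) (g a b))
        (doubleSum-+ i j _ _)

conv-distribˡ-⊞ : ∀ f g h → conv f (g ⊞ h) ≈ conv f g ⊞ conv f h
conv-distribˡ-⊞ f g h i j =
  trans (sumTo-cong i λ a _ → sumTo-cong j λ b _ →
           *-distribˡ-+ (f a b) (g (i ∸ a) (j ∸ b)) (h (i ∸ a) (j ∸ b)))
        (doubleSum-+ i j _ _)

monomial : ℕ → ℕ → ℕ → Poly
monomial c a b i j = c * (δ a i * δ b j)

conv-monomialˡ : ∀ c a b g i j →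
  conv (monomial c a b) g i j ≡ step a i * (step b j * (c * g (i ∸ a) (j ∸ b)))
conv-monomialˡ c a b g i j = begin
  sumTo i (λ x → sumTo j (λ y → c * (δ a x * δ b y) * g (i ∸ x) (j ∸ y)))
    ≡⟨ sumTo-cong i (λ x _ → sumTo-cong j λ y _ → regroup c (δ a x) (δ b y) _) ⟩
  sumTo i (λ x → sumTo j (λ y → δ b y * (δ a x * (c * g (i ∸ x) (j ∸ y)))))
    ≡⟨ sumTo-cong i (λ x _ → trans (sumTo-δ b j _) (swap (step b j) (δ a x) _)) ⟩
  sumTo i (λ x → δ a x * (step b j * (c * g (i ∸ x) (j ∸ b))))
    ≡⟨ sumTo-δ a i _ ⟩
  step a i * (step b j * (c * g (i ∸ a) (j ∸ b))) ∎
  where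
  open ≡-Reasoning
  regroup : ∀ c x y z → c * (x * y) * z ≡ y * (x * (c * z))
  regroup = solve-∀
  swap : ∀ u x w → u * (x * w) ≡ x * (u * w)
  swap = solve-∀

monomial-mul : ∀ c a b d a′ b′ →
  conv (monomial c a b) (monomial d a′ b′) ≈ monomial (c * d) (a + a′) (b + b′)
monomial-mul c a b d a′ b′ i j = begin
  conv (monomial c a b) (monomial d a′ b′) i j
    ≡⟨ conv-monomialˡ c a b (monomial d a′ b′) i j ⟩
  step a i * (step b j * (c * (d * (δ a′ (i ∸ a) * δ b′ (j ∸ b)))))
    ≡⟨ regroup (step a i) (step b j) c d (δ a′ (i ∸ a)) (δ b′ (j ∸ b)) ⟩
  c * d * (step a i * δ a′ (i ∸ a) * (step b j * δ b′ (j ∸ b)))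
    ≡⟨ cong₂ (λ u v → c * d * (u * v)) (step-δ a a′ i) (step-δ b b′ j) ⟩
  monomial (c * d) (a + a′) (b + b′) i j ∎
  where
  open ≡-Reasoning
  regroup : ∀ s t c d x y → s * (t * (c * (d * (x * y)))) ≡ c * d * (s * x * (t * y))
  regroup = solve-∀

infixl 7 _·z^_
_·z^_ : (ℕ → ℕ) → ℕ → Poly
(h ·z^ b) i j = δ b j * h i

IsDerivation : (Poly → Poly) → Set
IsDerivation ∂ = ∀ f g → ∂ (conv f g) ≈ conv (∂ f) g ⊞ conv f (∂ g)

⊞-isDerivation : ∀ ∂ ∂′ → IsDerivation ∂ → IsDerivation ∂′ → IsDerivation (λ f → ∂ f ⊞ ∂′ f)
⊞-isDerivation ∂ ∂′ ∂-leibniz ∂′-leibniz f g i j = begin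
  ∂ (conv f g) i j + ∂′ (conv f g) i j
    ≡⟨ cong₂ _+_ (∂-leibniz f g i j) (∂′-leibniz f g i j) ⟩
  conv (∂ f) g i j + conv f (∂ g) i j + (conv (∂′ f) g i j + conv f (∂′ g) i j)
    ≡⟨ +-interchange (conv (∂ f) g i j) _ _ _ ⟩
  conv (∂ f) g i j + conv (∂′ f) g i j + (conv f (∂ g) i j + conv f (∂′ g) i j)
    ≡⟨ sym (cong₂ _+_ (conv-distribʳ-⊞ (∂ f) (∂′ f) g i j) (conv-distribˡ-⊞ f (∂ g) (∂′ g) i j)) ⟩
  conv (∂ f ⊞ ∂′ f) g i j + conv f (∂ g ⊞ ∂′ g) i j ∎
  where open ≡-Reasoning

euler : (ℕ → ℕ → ℕ) → Poly → Poly
euler w f i j = w i j * f i j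

euler-cong : ∀ w {f g} → f ≈ g → euler w f ≈ euler w g
euler-cong w f≈g i j = cong (w i j *_) (f≈g i j)

euler-⊞ : ∀ w f g → euler w (f ⊞ g) ≈ euler w f ⊞ euler w g
euler-⊞ w f g i j = *-distribˡ-+ (w i j) (f i j) (g i j)

euler-monomial : ∀ w c a b → euler w (monomial c a b) ≈ monomial (w a b * c) a b
euler-monomial w c a b i j = begin
  w i j * (c * (δ a i * δ b j))    ≡⟨ regroup (w i j) c (δ a i) (δ b j) ⟩
  c * (δ a i * (δ b j * w i j))    ≡⟨ cong (λ t → c * (δ a i * t)) (δ-subst b j (w i)) ⟩
  c * (δ a i * (δ b j * w i b))    ≡⟨ cong (c *_) (δ-subst a i λ x → δ b j * w x b) ⟩
  c * (δ a i * (δ b j * w a b))    ≡⟨ regroup′ c (δ a i) (δ b j) (w a b) ⟩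
  w a b * c * (δ a i * δ b j)      ∎
  where
  open ≡-Reasoning
  regroup : ∀ w c x y → w * (c * (x * y)) ≡ c * (x * (y * w))
  regroup = solve-∀
  regroup′ : ∀ c x y w → c * (x * (y * w)) ≡ w * c * (x * y)
  regroup′ = solve-∀

euler-isDerivation : ∀ w → (∀ a b c d → w (a + c) (b + d) ≡ w a b + w c d) → IsDerivation (euler w)
euler-isDerivation w w-additive f g i j = begin
  w i j * sumTo i (λ a → sumTo j (λ b → f a b * g (i ∸ a) (j ∸ b)))
    ≡⟨ *-distribˡ-sumTo (w i j) i _ ⟩
  sumTo i (λ a → w i j * sumTo j (λ b → f a b * g (i ∸ a) (j ∸ b)))
    ≡⟨ sumTo-cong i (λ a _ → *-distribˡ-sumTo (w i j) j _) ⟩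
  sumTo i (λ a → sumTo j (λ b → w i j * (f a b * g (i ∸ a) (j ∸ b))))
    ≡⟨ sumTo-cong i (λ a a≤i → sumTo-cong j λ b b≤j →
         trans (cong (_* (f a b * g (i ∸ a) (j ∸ b))) (weight-split a≤i b≤j))
               (distrib (w a b) _ (f a b) _)) ⟩
  sumTo i (λ a → sumTo j (λ b → w a b * f a b * g (i ∸ a) (j ∸ b)
                              + f a b * (w (i ∸ a) (j ∸ b) * g (i ∸ a) (j ∸ b))))
    ≡⟨ doubleSum-+ i j _ _ ⟩
  (conv (euler w f) g ⊞ conv f (euler w g)) i j ∎
  where
  open ≡-Reasoning
  weight-split : ∀ {a b} → a ≤ i → b ≤ j → w i j ≡ w a b + w (i ∸ a) (j ∸ b)
  weight-split a≤i b≤j =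
    trans (sym (cong₂ w (m+[n∸m]≡n a≤i) (m+[n∸m]≡n b≤j))) (w-additive _ _ _ _)
  distrib : ∀ u v x y → (u + v) * (x * y) ≡ u * x * y + x * (v * y)
  distrib = solve-∀

mulX : Poly → Poly
mulX f zero    j = 0
mulX f (suc i) j = f i j

mulX-cong : ∀ {f g} → f ≈ g → mulX f ≈ mulX g
mulX-cong f≈g zero    j = refl
mulX-cong f≈g (suc i) j = f≈g i j

mulX-⊞ : ∀ f g → mulX (f ⊞ g) ≈ mulX f ⊞ mulX g
mulX-⊞ f g zero    j = refl
mulX-⊞ f g (suc i) j = refl

mulX-monomial : ∀ c a b → mulX (monomial c a b) ≈ monomial c (suc a) b
mulX-monomial c a b zero    j = sym (*-zeroʳ c)
mulX-monomial c a b (suc i) j = refl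

conv-mulXˡ : ∀ f g → conv (mulX f) g ≈ mulX (conv f g)
conv-mulXˡ f g zero    j = sumTo-zero j λ _ → refl
conv-mulXˡ f g (suc i) j =
  trans (sumTo-suc i _) (cong (_+ conv f g i j) (sumTo-zero j λ _ → refl))

conv-mulXʳ : ∀ f g → conv f (mulX g) ≈ mulX (conv f g)
conv-mulXʳ f g zero    j = sumTo-zero j λ b → *-zeroʳ (f 0 b)
conv-mulXʳ f g (suc i) j = begin
  sumTo i (λ a → sumTo j (λ b → f a b * mulX g (suc i ∸ a) (j ∸ b)))
    + sumTo j (λ b → f (suc i) b * mulX g (suc i ∸ suc i) (j ∸ b))
    ≡⟨ cong₂ _+_ (sumTo-cong i λ a a≤i → sumTo-cong j λ b _ →
                    cong (λ t → f a b * mulX g t (j ∸ b)) (+-∸-assoc 1 a≤i))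
                 (sumTo-zero j λ b → trans (cong (λ t → f (suc i) b * mulX g t (j ∸ b)) (n∸n≡0 i))
                                           (*-zeroʳ (f (suc i) b))) ⟩
  conv f g i j + 0
    ≡⟨ +-identityʳ _ ⟩
  conv f g i j ∎
  where open ≡-Reasoning

mulX-isDerivation : ∀ ∂ → IsDerivation ∂ → IsDerivation (mulX ∘ ∂)
mulX-isDerivation ∂ ∂-leibniz f g =
  ≈-trans (mulX-cong (∂-leibniz f g)) (≈-trans (mulX-⊞ _ _)
    (⊞-cong (≈-sym (conv-mulXˡ (∂ f) g)) (≈-sym (conv-mulXʳ f (∂ g)))))

degX degZ : ℕ → ℕ → ℕ
degX i _ = i
degZ _ j = j

𝒟 : Poly → Poly
𝒟 f = mulX (euler degX f) ⊞ mulX (mulX (euler degZ f))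

𝒟-cong : ∀ {f g} → f ≈ g → 𝒟 f ≈ 𝒟 g
𝒟-cong f≈g =
  ⊞-cong (mulX-cong (euler-cong degX f≈g)) (mulX-cong (mulX-cong (euler-cong degZ f≈g)))

𝒟-⊞ : ∀ f g → 𝒟 (f ⊞ g) ≈ 𝒟 f ⊞ 𝒟 g
𝒟-⊞ f g i j = trans
  (cong₂ _+_ (trans (mulX-cong (euler-⊞ degX f g) i j) (mulX-⊞ (euler degX f) (euler degX g) i j))
             (trans (mulX-cong (mulX-cong (euler-⊞ degZ f g)) i j)
                    (trans (mulX-cong (mulX-⊞ (euler degZ f) (euler degZ g)) i j)
                           (mulX-⊞ (mulX (euler degZ f)) (mulX (euler degZ g)) i j))))
  (+-interchange (mulX (euler degX f) i j) _ _ _)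

𝒟-monomial : ∀ c a b → 𝒟 (monomial c a b) ≈ monomial (a * c) (1 + a) b ⊞ monomial (b * c) (2 + a) b
𝒟-monomial c a b =
  ⊞-cong (≈-trans (mulX-cong (euler-monomial degX c a b)) (mulX-monomial (a * c) a b))
         (≈-trans (mulX-cong (≈-trans (mulX-cong (euler-monomial degZ c a b)) (mulX-monomial (b * c) a b)))
                  (mulX-monomial (b * c) (suc a) b))

𝒟-isDerivation : IsDerivation 𝒟
𝒟-isDerivation =
  ⊞-isDerivation (mulX ∘ euler degX) (mulX ∘ mulX ∘ euler degZ)
    (mulX-isDerivation (euler degX) (euler-isDerivation degX λ _ _ _ _ → refl))
    (mulX-isDerivation (mulX ∘ euler degZ)
      (mulX-isDerivation (euler degZ) (euler-isDerivation degZ λ _ _ _ _ → refl)))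

⟦lit⟧≈monomial : ∀ c → ⟦ lit c ⟧ ≈ monomial c 0 0
⟦lit⟧≈monomial c zero    zero    = sym (*-identityʳ c)
⟦lit⟧≈monomial c zero    (suc j) = sym (*-zeroʳ c)
⟦lit⟧≈monomial c (suc i) j       = sym (*-zeroʳ c)

⟦X⟧≈monomial : ⟦ X ⟧ ≈ monomial 1 1 0
⟦X⟧≈monomial zero                zero    = refl
⟦X⟧≈monomial zero                (suc j) = refl
⟦X⟧≈monomial (suc zero)          zero    = refl
⟦X⟧≈monomial (suc zero)          (suc j) = refl
⟦X⟧≈monomial (suc (suc i))       j       = refl

⟦Z⟧≈monomial : ⟦ Z ⟧ ≈ monomial 1 0 1
⟦Z⟧≈monomial zero    zero          = refl
⟦Z⟧≈monomial zero    (suc zero)    = refl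
⟦Z⟧≈monomial zero    (suc (suc j)) = refl
⟦Z⟧≈monomial (suc i) j             = refl

⟦X^⟧≈monomial : ∀ n → ⟦ X^ n ⟧ ≈ monomial 1 n 0
⟦X^⟧≈monomial zero    = ⟦lit⟧≈monomial 1
⟦X^⟧≈monomial (suc n) i j =
  trans (conv-cong (⟦X^⟧≈monomial n) ⟦X⟧≈monomial i j)
        (trans (monomial-mul 1 n 0 1 1 0 i j) (cong (λ k → monomial 1 k 0 i j) (+-comm n 1)))

⟦X⊗X⟧≈monomial : ⟦ X ⊗ X ⟧ ≈ monomial 1 2 0
⟦X⊗X⟧≈monomial = ≈-trans (conv-cong ⟦X⟧≈monomial ⟦X⟧≈monomial) (monomial-mul 1 1 0 1 1 0)

⟦lit⊗X^⟧≈monomial : ∀ c k → ⟦ lit c ⊗ X^ k ⟧ ≈ monomial (c * 1) k 0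
⟦lit⊗X^⟧≈monomial c k =
  ≈-trans (conv-cong (⟦lit⟧≈monomial c) (⟦X^⟧≈monomial k)) (monomial-mul c 0 0 1 k 0)

⟦D⟧≈𝒟⟦⟧ : ∀ p → ⟦ D p ⟧ ≈ 𝒟 ⟦ p ⟧
⟦D⟧≈𝒟⟦⟧ (lit c) =
  ≈-trans (⟦lit⟧≈monomial 0) (≈-sym (≈-trans (𝒟-cong (⟦lit⟧≈monomial c)) (𝒟-monomial c 0 0)))
⟦D⟧≈𝒟⟦⟧ X i j = trans (⟦X⊗X⟧≈monomial i j)
  (sym (trans (𝒟-cong ⟦X⟧≈monomial i j) (trans (𝒟-monomial 1 1 0 i j) (+-identityʳ _))))
⟦D⟧≈𝒟⟦⟧ Z = ≈-trans (conv-cong ⟦X⊗X⟧≈monomial ⟦Z⟧≈monomial)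
  (≈-trans (monomial-mul 1 2 0 1 0 1) (≈-sym (≈-trans (𝒟-cong ⟦Z⟧≈monomial) (𝒟-monomial 1 0 1))))
⟦D⟧≈𝒟⟦⟧ (p ⊕ q) = ≈-trans (⊞-cong (⟦D⟧≈𝒟⟦⟧ p) (⟦D⟧≈𝒟⟦⟧ q)) (≈-sym (𝒟-⊞ ⟦ p ⟧ ⟦ q ⟧))
⟦D⟧≈𝒟⟦⟧ (p ⊗ q) =
  ≈-trans (⊞-cong (conv-cong (⟦D⟧≈𝒟⟦⟧ p) (≈-refl {⟦ q ⟧})) (conv-cong (≈-refl {⟦ p ⟧}) (⟦D⟧≈𝒟⟦⟧ q)))
          (≈-sym (𝒟-isDerivation ⟦ p ⟧ ⟦ q ⟧))

x²[1+d/dx] : (ℕ → ℕ) → ℕ → ℕ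
x²[1+d/dx] h zero          = 0
x²[1+d/dx] h (suc zero)    = 0
x²[1+d/dx] h (suc (suc i)) = suc i * h (suc i) + h i

𝒟-·z : ∀ h → 𝒟 (h ·z^ 1) ≈ x²[1+d/dx] h ·z^ 1
𝒟-·z h zero          j = sym (*-zeroʳ (δ 1 j))
𝒟-·z h (suc zero)    j = sym (*-zeroʳ (δ 1 j))
𝒟-·z h (suc (suc i)) j = begin
  suc i * (δ 1 j * h (suc i)) + j * (δ 1 j * h i)
    ≡⟨ cong (suc i * (δ 1 j * h (suc i)) +_) (regroup j (δ 1 j) (h i)) ⟩
  suc i * (δ 1 j * h (suc i)) + δ 1 j * j * h i
    ≡⟨ cong (λ t → suc i * (δ 1 j * h (suc i)) + t * h i) (δ-subst 1 j λ x → x) ⟩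
  suc i * (δ 1 j * h (suc i)) + δ 1 j * 1 * h i
    ≡⟨ regroup′ (suc i) (δ 1 j) (h (suc i)) (h i) ⟩
  δ 1 j * (suc i * h (suc i) + h i) ∎
  where
  open ≡-Reasoning
  regroup : ∀ j d x → j * (d * x) ≡ d * j * x
  regroup = solve-∀
  regroup′ : ∀ a d y x → a * (d * y) + d * 1 * x ≡ d * (a * y + x)
  regroup′ = solve-∀

dⁿzCoeff : ℕ → ℕ → ℕ
dⁿzCoeff zero    = δ 0
dⁿzCoeff (suc n) = x²[1+d/dx] (dⁿzCoeff n)

⟦Dⁿz⟧≈dⁿzCoeff·z : ∀ n → ⟦ Dⁿ n Z ⟧ ≈ dⁿzCoeff n ·z^ 1
⟦Dⁿz⟧≈dⁿzCoeff·z zero    = ≈-trans ⟦Z⟧≈monomial λ i j → trans (+-identityʳ _) (*-comm (δ 0 i) (δ 1 j))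
⟦Dⁿz⟧≈dⁿzCoeff·z (suc n) =
  ≈-trans (⟦D⟧≈𝒟⟦⟧ (Dⁿ n Z)) (≈-trans (𝒟-cong (⟦Dⁿz⟧≈dⁿzCoeff·z n)) (𝒟-·z (dⁿzCoeff n)))

lahRec : ℕ → ℕ → ℕ
lahRec zero    k       = δ 0 k
lahRec (suc n) zero    = n * lahRec n zero
lahRec (suc n) (suc k) = (n + suc k) * lahRec n (suc k) + lahRec n k

lahRec-zero : ∀ n → lahRec (suc n) 0 ≡ 0
lahRec-zero zero    = refl
lahRec-zero (suc n) = trans (cong (suc n *_) (lahRec-zero n)) (*-zeroʳ (suc n))

absorption : ∀ n k → suc k * (n C suc k) + k * (n C k) ≡ n * (n C k)
absorption zero    zero    = refl
absorption zero    (suc k) = cong₂ _+_ (*-zeroʳ (suc (suc k))) (*-zeroʳ (suc k))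
absorption (suc n) zero    =
  trans (+-identityʳ _) (trans (+-identityʳ _) (trans (nC1≡n (suc n)) (sym (*-identityʳ (suc n)))))
absorption (suc n) (suc k) =
  subst₂ (λ u v → suc (suc k) * u + suc k * v ≡ suc n * v)
    (nCk+nC[k+1]≡[n+1]C[k+1] n (suc k)) (nCk+nC[k+1]≡[n+1]C[k+1] n k)
    (combine (absorption n (suc k)) (absorption n k))
  where
  combine : ∀ {a b c} → (2 + k) * c + (1 + k) * b ≡ n * b → (1 + k) * b + k * a ≡ n * a →
          (2 + k) * (b + c) + (1 + k) * (a + b) ≡ (1 + n) * (a + b)
  combine {a} {b} {c} h₁ h₂ = begin
    (2 + k) * (b + c) + (1 + k) * (a + b)                    ≡⟨ r₁ k a b c ⟩
    (2 + k) * b + ((2 + k) * c + (1 + k) * b) + (1 + k) * a  ≡⟨ cong (λ t → (2 + k) * b + t + (1 + k) * a) h₁ ⟩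
    (2 + k) * b + n * b + (1 + k) * a                        ≡⟨ r₂ k n a b ⟩
    a + b + ((1 + k) * b + k * a) + n * b                    ≡⟨ cong (λ t → a + b + t + n * b) h₂ ⟩
    a + b + n * a + n * b                                    ≡⟨ r₃ n a b ⟩
    (1 + n) * (a + b)                                        ∎
    where
    open ≡-Reasoning
    r₁ : ∀ k a b c → (2 + k) * (b + c) + (1 + k) * (a + b)
                       ≡ (2 + k) * b + ((2 + k) * c + (1 + k) * b) + (1 + k) * a
    r₁ = solve-∀
    r₂ : ∀ k n a b → (2 + k) * b + n * b + (1 + k) * a ≡ a + b + ((1 + k) * b + k * a) + n * b
    r₂ = solve-∀
    r₃ : ∀ n a b → a + b + n * a + n * b ≡ (1 + n) * (a + b)
    r₃ = solve-∀

lahRec-closedForm : ∀ n k → lahRec (suc n) (suc k) * (suc k) ! ≡ (n C k) * (suc n) !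
lahRec-closedForm zero    zero    = refl
lahRec-closedForm zero    (suc k) = cong (_* (suc (suc k)) !) (trans (+-identityʳ _) (*-zeroʳ (suc (suc k))))
lahRec-closedForm (suc n) zero    = begin
  ((suc n + 1) * lahRec (suc n) 1 + lahRec (suc n) 0) * 1
    ≡⟨ cong (λ t → ((suc n + 1) * lahRec (suc n) 1 + t) * 1) (lahRec-zero n) ⟩
  ((suc n + 1) * lahRec (suc n) 1 + 0) * 1
    ≡⟨ r₁ (suc n) (lahRec (suc n) 1) ⟩
  (suc n + 1) * (lahRec (suc n) 1 * 1)
    ≡⟨ cong ((suc n + 1) *_) (lahRec-closedForm n 0) ⟩
  (suc n + 1) * (1 * (suc n) !)
    ≡⟨ r₂ n ((suc n) !) ⟩
  1 * (suc (suc n)) ! ∎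
  where
  open ≡-Reasoning
  r₁ : ∀ m x → ((m + 1) * x + 0) * 1 ≡ (m + 1) * (x * 1)
  r₁ = solve-∀
  r₂ : ∀ n f → (1 + n + 1) * (1 * f) ≡ 1 * ((2 + n) * f)
  r₂ = solve-∀
lahRec-closedForm (suc n) (suc k) =
  subst (λ v → ((suc n + suc (suc k)) * lahRec (suc n) (suc (suc k)) + lahRec (suc n) (suc k)) * (suc (suc k)) !
               ≡ v * (suc (suc n)) !)
    (nCk+nC[k+1]≡[n+1]C[k+1] n k)
    (combine (lahRec (suc n) (suc (suc k))) (lahRec (suc n) (suc k)) ((suc k) !)
             (lahRec-closedForm n (suc k)) (lahRec-closedForm n k) (absorption n k))
  where
  combine : ∀ p q F {G a b} → p * ((2 + k) * F) ≡ b * G → q * F ≡ a * G → (1 + k) * b + k * a ≡ n * a →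
            ((1 + n + (2 + k)) * p + q) * ((2 + k) * F) ≡ (a + b) * ((2 + n) * G)
  combine p q F {G} {a} {b} h₁ h₂ h₃ = begin
    ((1 + n + (2 + k)) * p + q) * ((2 + k) * F)             ≡⟨ r₁ n k p q F ⟩
    (3 + n + k) * (p * ((2 + k) * F)) + (2 + k) * (q * F)   ≡⟨ cong₂ (λ u v → (3 + n + k) * u + (2 + k) * v) h₁ h₂ ⟩
    (3 + n + k) * (b * G) + (2 + k) * (a * G)               ≡⟨ r₂ n k G a b ⟩
    (2 * a + 2 * b + n * b + ((1 + k) * b + k * a)) * G     ≡⟨ cong (λ t → (2 * a + 2 * b + n * b + t) * G) h₃ ⟩
    (2 * a + 2 * b + n * b + n * a) * G                     ≡⟨ r₃ n G a b ⟩
    (a + b) * ((2 + n) * G)                                 ∎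
    where
    open ≡-Reasoning
    r₁ : ∀ n k p q F → ((1 + n + (2 + k)) * p + q) * ((2 + k) * F)
                         ≡ (3 + n + k) * (p * ((2 + k) * F)) + (2 + k) * (q * F)
    r₁ = solve-∀
    r₂ : ∀ n k G a b → (3 + n + k) * (b * G) + (2 + k) * (a * G)
                         ≡ (2 * a + 2 * b + n * b + ((1 + k) * b + k * a)) * G
    r₂ = solve-∀
    r₃ : ∀ n G a b → (2 * a + 2 * b + n * b + n * a) * G ≡ (a + b) * ((2 + n) * G)
    r₃ = solve-∀

lahRec≡Lah : ∀ n k → lahRec (suc n) (suc k) ≡ Lah (suc n) (suc k)
lahRec≡Lah n k with suc k ≤? suc n
... | yes k≤n = sym (begin
  (n C k) * ((suc n) ! / (suc k) !)               ≡⟨ *-/-assoc (n C k) (∣-trans (m∣m*n _) (k![n∸k]!∣n! k≤n)) ⟨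
  (n C k) * (suc n) ! / (suc k) !                 ≡⟨ cong (_/ (suc k) !) (lahRec-closedForm n k) ⟨
  lahRec (suc n) (suc k) * (suc k) ! / (suc k) !  ≡⟨ m*n/n≡m (lahRec (suc n) (suc k)) ((suc k) !) ⟩
  lahRec (suc n) (suc k)                          ∎)
  where
  open ≡-Reasoning
  instance _ = (suc k) !≢0
-- Beyond the diagonal C(n,k) = 0, so the closed form forces lahRec to vanish as well.
... | no k≰n = trans (m*n≡0⇒m≡0 _ ((suc k) !) (trans (lahRec-closedForm n k) (cong (_* (suc n) !) nCk≡0)))
                     (sym (cong (_* ((suc n) ! / (suc k) !)) nCk≡0))
  where
  instance _ = (suc k) !≢0
  nCk≡0 : n C k ≡ 0
  nCk≡0 = k>n⇒nCk≡0 (≤-pred (≰⇒> k≰n))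

lahRec-vanishes : ∀ {n k} → n < k → lahRec (suc n) (suc k) ≡ 0
lahRec-vanishes {n} {k} n<k =
  trans (lahRec≡Lah n k) (cong (λ c → c * ((suc n) ! / (suc k) !)) (k>n⇒nCk≡0 n<k))
  where instance _ = (suc k) !≢0

dⁿzCoeff-below : ∀ n i → i < n → dⁿzCoeff n i ≡ 0
dⁿzCoeff-below (suc n) zero          _         = refl
dⁿzCoeff-below (suc n) (suc zero)    _         = refl
dⁿzCoeff-below (suc n) (suc (suc i)) (s≤s i<n) =
  cong₂ _+_ (trans (cong (suc i *_) (dⁿzCoeff-below n (suc i) i<n)) (*-zeroʳ (suc i)))
            (dⁿzCoeff-below n i (<-trans (n<1+n i) i<n))

dⁿzCoeff-diagonal : ∀ n k → dⁿzCoeff n (n + k) ≡ lahRec n k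
dⁿzCoeff-diagonal zero          k       = refl
dⁿzCoeff-diagonal (suc zero)    zero    = refl
dⁿzCoeff-diagonal (suc zero)    (suc k) = refl
dⁿzCoeff-diagonal (suc (suc n)) zero    =
  trans (cong₂ _+_ (cong₂ _*_ (cong suc (+-identityʳ n)) (dⁿzCoeff-diagonal (suc n) 0))
                   (dⁿzCoeff-below (suc n) (n + 0) (s≤s (≤-reflexive (+-identityʳ n)))))
        (+-identityʳ _)
dⁿzCoeff-diagonal (suc (suc n)) (suc k) =
  cong₂ _+_ (cong (suc (n + suc k) *_) (dⁿzCoeff-diagonal (suc n) (suc k)))
            (trans (cong (dⁿzCoeff (suc n)) (+-suc n k)) (dⁿzCoeff-diagonal (suc n) k))

dⁿzCoeff≡step*lahRec : ∀ n i → dⁿzCoeff n i ≡ step n i * lahRec n (i ∸ n)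
dⁿzCoeff≡step*lahRec n i with n ≤? i
... | yes n≤i = trans (cong (dⁿzCoeff n) (sym (m+[n∸m]≡n n≤i)))
                (trans (dⁿzCoeff-diagonal n (i ∸ n)) (sym (trans (cong (_* L) (step-≤ n≤i)) (+-identityʳ L))))
  where L = lahRec n (i ∸ n)
... | no n≰i  = trans (dⁿzCoeff-below n i (≰⇒> n≰i)) (sym (cong (_* lahRec n (i ∸ n)) (step-> (≰⇒> n≰i))))

⟦lahSum⟧≈step*lahRec : ∀ n m → ⟦ lahSum (suc n) m ⟧ ≈ (λ i → step i m * lahRec (suc n) i) ·z^ 0
⟦lahSum⟧≈step*lahRec n zero zero j =
  trans (⟦lit⟧≈monomial 0 0 j) (sym (trans (cong (λ t → δ 0 j * (1 * t)) (lahRec-zero n)) (*-zeroʳ (δ 0 j))))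
⟦lahSum⟧≈step*lahRec n zero (suc i) j = trans (⟦lit⟧≈monomial 0 (suc i) j) (sym (*-zeroʳ (δ 0 j)))
⟦lahSum⟧≈step*lahRec n (suc m) i j = begin
  ⟦ lahSum (suc n) m ⟧ i j + ⟦ lit (Lah (suc n) (suc m)) ⊗ X^ (suc m) ⟧ i j
    ≡⟨ cong₂ _+_ (⟦lahSum⟧≈step*lahRec n m i j) (⟦lit⊗X^⟧≈monomial _ (suc m) i j) ⟩
  δ 0 j * (step i m * L i) + Lah (suc n) (suc m) * 1 * (δ (suc m) i * δ 0 j)
    ≡⟨ cong (λ c → δ 0 j * (step i m * L i) + c * 1 * (δ (suc m) i * δ 0 j)) (sym (lahRec≡Lah n m)) ⟩
  δ 0 j * (step i m * L i) + L (suc m) * 1 * (δ (suc m) i * δ 0 j)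
    ≡⟨ regroup (δ 0 j) (step i m) (L i) (L (suc m)) (δ (suc m) i) ⟩
  δ 0 j * (step i m * L i + δ (suc m) i * L (suc m))
    ≡⟨ cong (λ t → δ 0 j * (step i m * L i + t)) (sym (δ-subst (suc m) i L)) ⟩
  δ 0 j * (step i m * L i + δ (suc m) i * L i)
    ≡⟨ cong (δ 0 j *_) (sym (trans (cong (_* L i) (step-suc i m)) (*-distribʳ-+ (L i) (step i m) _))) ⟩
  δ 0 j * (step i (suc m) * L i) ∎
  where
  open ≡-Reasoning
  L = lahRec (suc n)
  regroup : ∀ d s x y e → d * (s * x) + y * 1 * (e * d) ≡ d * (s * x + e * y)
  regroup = solve-∀

step*lahRec≡lahRec : ∀ n i → step i (suc n) * lahRec (suc n) i ≡ lahRec (suc n) i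
step*lahRec≡lahRec n zero = *-identityˡ (lahRec (suc n) 0)
step*lahRec≡lahRec n (suc k) with k ≤? n
... | yes k≤n = trans (cong (_* lahRec (suc n) (suc k)) (step-≤ (s≤s k≤n))) (*-identityˡ _)
... | no k≰n  = trans (cong (step k n *_) vanishes) (trans (*-zeroʳ (step k n)) (sym vanishes))
  where vanishes = lahRec-vanishes (≰⇒> k≰n)

⟦X^⊗Z⊗⟧≈shift : ∀ m q g → ⟦ q ⟧ ≈ g ·z^ 0 → ⟦ X^ m ⊗ Z ⊗ q ⟧ ≈ (λ i → step m i * g (i ∸ m)) ·z^ 1
⟦X^⊗Z⊗⟧≈shift m q g ⟦q⟧≈g i j = begin
  conv ⟦ X^ m ⊗ Z ⟧ ⟦ q ⟧ i j
    ≡⟨ conv-cong ⟦X^m⊗Z⟧≈monomial ⟦q⟧≈g i j ⟩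
  conv (monomial 1 m 1) (g ·z^ 0) i j
    ≡⟨ conv-monomialˡ 1 m 1 (g ·z^ 0) i j ⟩
  step m i * (step 1 j * (1 * (δ 0 (j ∸ 1) * g (i ∸ m))))
    ≡⟨ regroup (step m i) (step 1 j) (δ 0 (j ∸ 1)) (g (i ∸ m)) ⟩
  step 1 j * δ 0 (j ∸ 1) * (step m i * g (i ∸ m))
    ≡⟨ cong (_* (step m i * g (i ∸ m))) (step-δ 1 0 j) ⟩
  δ 1 j * (step m i * g (i ∸ m)) ∎
  where
  open ≡-Reasoning
  ⟦X^m⊗Z⟧≈monomial : ⟦ X^ m ⊗ Z ⟧ ≈ monomial 1 m 1
  ⟦X^m⊗Z⟧≈monomial i j = trans (conv-cong (⟦X^⟧≈monomial m) ⟦Z⟧≈monomial i j)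
    (trans (monomial-mul 1 m 0 1 0 1 i j) (cong (λ k → monomial 1 k 1 i j) (+-identityʳ m)))
  regroup : ∀ s t d x → s * (t * (1 * (d * x))) ≡ t * d * (s * x)
  regroup = solve-∀

⟦lahSum⟧≈lahRec : ∀ n → ⟦ lahSum (suc n) (suc n) ⟧ ≈ lahRec (suc n) ·z^ 0
⟦lahSum⟧≈lahRec n i j =
  trans (⟦lahSum⟧≈step*lahRec n (suc n) i j) (cong (δ 0 j *_) (step*lahRec≡lahRec n i))

corollary2p5 : (n : ℕ) → 1 ≤ n → (i j : ℕ) →
    ⟦ Dⁿ n Z ⟧ i j ≡ ⟦ X^ n ⊗ Z ⊗ lahSum n n ⟧ i j
corollary2p5 (suc n) _ i j = begin
  ⟦ Dⁿ (suc n) Z ⟧ i j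
    ≡⟨ ⟦Dⁿz⟧≈dⁿzCoeff·z (suc n) i j ⟩
  δ 1 j * dⁿzCoeff (suc n) i
    ≡⟨ cong (δ 1 j *_) (dⁿzCoeff≡step*lahRec (suc n) i) ⟩
  δ 1 j * (step (suc n) i * lahRec (suc n) (i ∸ suc n))
    ≡⟨ ⟦X^⊗Z⊗⟧≈shift (suc n) (lahSum (suc n) (suc n)) (lahRec (suc n)) (⟦lahSum⟧≈lahRec n) i j ⟨
  ⟦ X^ (suc n) ⊗ Z ⊗ lahSum (suc n) (suc n) ⟧ i j ∎
  where open ≡-Reasoning
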